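{- In the level-constrained optimization framework described in the context, for each candidate replacement of $x$ by $x'$ in the current AIG $G_i$, the procedure dynLev correctly computes $\mathcal{L}(x')$, i.e. the stored value equals the level of $x'$ in $G_i$.
   Context: An AIG is a DAG of primary inputs and 2-input AND nodes; the level is $\mathcal{L}(n) = 1 + \max\{\mathcal{L}(f): f\in\mathrm{fanin}(n)\}$ with a base value at primary inputs. Framework: levels are computed initially for all of $V$; nodes of the original graph are processed in a partial topological order $\mathcal{T}$ of unhandled nodes (maintained so that for unhandled $m,n$, a path $m\to n$ in the current graph implies $m$ precedes $n$ in $\mathcal{T}$). When node $x$ is processed it is marked handled and dynLev is called on $\{x\}$; a local transformation may produce a logically equivalent subgraph $\Delta G_i$ rooted at $x'$ whose inputs are the nodes of a $k$-feasible cut of $x$; if applied, all fanouts of $x$ are redirected to $x'$, fanout-free nodes are recursively deleted, and dynLev is called on the set $\mathcal{I}$ of newly inserted nodes in the order they were created (fanins before fanouts). Procedure dynLev, given a node set $U$, sets $\mathcal{L}(n) \gets 1 + \max\{\mathcal{L}(f): f\in \mathrm{fanin}(n)\}$ for each $n\in U$ in turn; no other levels are updated. -}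

module Defs where

open import Data.Nat using (ℕ; zero; suc; _≤_; _⊔_; _≡ᵇ_)
open import Data.Bool using (Bool; true; false; if_then_else_; _xor_; _∧_; _∨_; not)
open import Data.List using (List; []; _∷_; _++_; [_]; map; length)
open import Data.List.Membership.Propositional using (_∈_; _∉_)
open import Data.List.Relation.Unary.All using (All)
open import Data.List.Relation.Unary.Any using (Any)
open import Data.List.Relation.Unary.Unique.Propositional using (Unique)
open import Data.Product using (Σ; ∃; _×_; _,_)
open import Data.Sum using (_⊎_)
open import Data.Unit using (⊤)
open import Relation.Nullary using (¬_)
open import Relation.Binary.PropositionalEquality using (_≡_)
open import Function.Bundles using (_⇔_)

-- Nodes are identified by natural numbers.  An edge into an AND node is
-- a literal: a node together with a complementation flag.

record Lit : Set where
  constructor lit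
  field
    node : ℕ
    neg  : Bool
open Lit public

data Kind : Set where
  none : Kind               -- no node with this identifier
  pi   : Kind
  and  : Lit → Lit → Kind

record AIG : Set where
  constructor aig
  field
    gate : ℕ → Kind
    outs : List Lit
open AIG public

Present : AIG → ℕ → Set
Present G n = ¬ (gate G n ≡ none)

data FaninOf (G : AIG) (f n : ℕ) : Set where
  fan₁ : ∀ {a b} → gate G n ≡ and a b → node a ≡ f → FaninOf G f n
  fan₂ : ∀ {a b} → gate G n ≡ and a b → node b ≡ f → FaninOf G f n

data Path (G : AIG) : ℕ → ℕ → Set where
  here : ∀ {n} → Path G n n
  step : ∀ {m k n} → FaninOf G m k → Path G k n → Path G m n

Path⁺ : AIG → ℕ → ℕ → Set
Path⁺ G m n = ∃ λ k → FaninOf G m k × Path G k n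

verts : ∀ {G m n} → Path G m n → List ℕ
verts {n = n} here = n ∷ []
verts {m = m} (step _ p) = m ∷ verts p

Acyclic : AIG → Set
Acyclic G = ∀ n → ¬ Path⁺ G n n

Finite : AIG → Set
Finite G = ∃ λ N → ∀ n → N ≤ n → gate G n ≡ none

FaninsPresent : AIG → Set
FaninsPresent G = ∀ f n → FaninOf G f n → Present G f

IsDAG : AIG → Set
IsDAG G = Finite G × Acyclic G × FaninsPresent G

data Level (base : ℕ) (G : AIG) : ℕ → ℕ → Set where
  lpi  : ∀ {n} → gate G n ≡ pi → Level base G n base
  land : ∀ {n a b la lb} → gate G n ≡ and a b →
         Level base G (node a) la → Level base G (node b) lb →
         Level base G n (suc (la ⊔ lb))

data Eval (G : AIG) (ρ : ℕ → Bool) : ℕ → Bool → Set where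
  epi  : ∀ {n} → gate G n ≡ pi → Eval G ρ n (ρ n)
  eand : ∀ {n a b u v} → gate G n ≡ and a b →
         Eval G ρ (node a) u → Eval G ρ (node b) v →
         Eval G ρ n ((u xor neg a) ∧ (v xor neg b))

IsCut : AIG → List ℕ → ℕ → Set
IsCut G C n = ∀ p → gate G p ≡ pi → (π : Path G p n) → Any (_∈ C) (verts π)

KFeasibleCut : ℕ → AIG → List ℕ → ℕ → Set
KFeasibleCut k G C n = length C ≤ k × IsCut G C n × (∀ c → c ∈ C → Path G c n)

-- Candidate subgraphs ΔG, given as the list of newly created AND nodes
-- in creation order (fanins before fanouts); the root x' is the last
-- created node; `pol` is the polarity with which x' replaces x.

record NewNode : Set where
  constructor newNode
  field
    nid : ℕ
    fa  : Lit
    fb  : Lit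
open NewNode public

record Candidate : Set where
  constructor candidate
  field
    leaves : List ℕ
    body   : List NewNode
    root   : NewNode
    pol    : Bool
open Candidate public

created : Candidate → List NewNode
created c = body c ++ [ root c ]

inserted : Candidate → List ℕ
inserted c = map nid (created c)

Built : List ℕ → List NewNode → Set
Built av [] = ⊤
Built av (d ∷ ds) = (node (fa d) ∈ av) × (node (fb d) ∈ av) × Built (nid d ∷ av) ds

setGate : AIG → ℕ → Kind → AIG
setGate G i k = aig (λ n → if n ≡ᵇ i then k else gate G n) (outs G)

insertNodes : AIG → List NewNode → AIG
insertNodes G [] = G
insertNodes G (d ∷ ds) = insertNodes (setGate G (nid d) (and (fa d) (fb d))) ds

insertCand : AIG → Candidate → AIG
insertCand G c = insertNodes G (created c)

ValidCandidate : ℕ → AIG → ℕ → Candidate → Set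
ValidCandidate k G x c =
  KFeasibleCut k G (leaves c) x ×
  All (λ d → gate G (nid d) ≡ none) (created c) ×
  Unique (inserted c) ×
  Built (leaves c) (created c) ×
  (∀ ρ v → Eval (insertCand G c) ρ x v ⇔ Eval (insertCand G c) ρ (nid (root c)) (v xor pol c))

updateAt : (ℕ → ℕ) → ℕ → ℕ → (ℕ → ℕ)
updateAt L i v n = if n ≡ᵇ i then v else L n

recompute : (ℕ → ℕ) → ℕ → Kind → (ℕ → ℕ)
recompute L n (and a b) = updateAt L n (suc (L (node a) ⊔ L (node b)))
recompute L n _ = L

dynLev : AIG → (ℕ → ℕ) → List ℕ → (ℕ → ℕ)
dynLev G L [] = L
dynLev G L (n ∷ ns) = dynLev G (recompute L n (gate G n)) ns

redirectLit : ℕ → Lit → Lit → Lit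
redirectLit x (lit x' c) (lit m s) = if m ≡ᵇ x then lit x' (c xor s) else lit m s

isIn : ℕ → List ℕ → Bool
isIn n [] = false
isIn n (m ∷ ms) = (n ≡ᵇ m) ∨ isIn n ms

redirectKind : ℕ → Lit → Kind → Kind
redirectKind x l (and a b) = and (redirectLit x l a) (redirectLit x l b)
redirectKind x l k = k

redirect : AIG → List ℕ → ℕ → Lit → AIG
redirect G I x l =
  aig (λ n → if isIn n I then gate G n else redirectKind x l (gate G n))
      (map (redirectLit x l) (outs G))

HasFanout : AIG → ℕ → Set
HasFanout G y = (∃ λ n → FaninOf G y n) ⊎ Any (λ o → node o ≡ y) (outs G)

IsAnd : AIG → ℕ → Set
IsAnd G y = ∃ λ a → ∃ λ b → gate G y ≡ and a b

data Delete : AIG → List ℕ → AIG → Set where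
  done : ∀ {G} → Delete G [] G
  del  : ∀ {G G' y ws a b} → gate G y ≡ and a b → ¬ HasFanout G y →
         Delete (setGate G y none) (ws ++ node a ∷ node b ∷ []) G' →
         Delete G (y ∷ ws) G'
  keep : ∀ {G G' y ws} → (¬ IsAnd G y ⊎ HasFanout G y) →
         Delete G ws G' → Delete G (y ∷ ws) G'

-- The framework as a transition system on states
--   (current AIG, stored levels 𝓛, order 𝓣 of unhandled nodes)

record State : Set where
  constructor st
  field
    graph  : AIG
    levels : ℕ → ℕ
    order  : List ℕ
open State public

data Before : List ℕ → ℕ → ℕ → Set where
  bhere  : ∀ {m n T} → n ∈ T → Before (m ∷ T) m n
  bthere : ∀ {m n y T} → Before T m n → Before (y ∷ T) m n

Initial : ℕ → State → Set
Initial base (st G₀ L₀ T₀) =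
  IsDAG G₀ ×
  (∀ n → Present G₀ n → Level base G₀ n (L₀ n)) ×
  (∀ n → Present G₀ n → n ∈ T₀) ×
  All (Present G₀) T₀ ×
  Unique T₀ ×
  (∀ m n → m ∈ T₀ → n ∈ T₀ → Path⁺ G₀ m n → Before T₀ m n)

data Step (k : ℕ) : State → State → Set where
  noChange : ∀ {G L x T} →
    Step k (st G L (x ∷ T)) (st G (dynLev G L [ x ]) T)
  replace  : ∀ {G L x T c G₂} →
    ValidCandidate k G x c →
    Delete (redirect (insertCand G c) (inserted c) x (lit (nid (root c)) (pol c))) [ x ] G₂ →
    Step k (st G L (x ∷ T))
           (st G₂ (dynLev G₂ (dynLev G L [ x ]) (inserted c)) T)

data Reachable (k base : ℕ) : State → Set where
  init : ∀ {S} → Initial base S → Reachable k base S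
  next : ∀ {S S'} → Reachable k base S → Step k S S' → Reachable k base S'

-- Every reachable state satisfies an invariant: each processed node, and each primary input,
-- stores its true level, and the pending list is a topological order closed under fanouts.
-- Processing x preserves it because all fanins of x are already processed. For a candidate,
-- the cut leaves lie upstream of x, hence are processed, and their levels are unchanged by
-- inserting the new nodes; dynLev over the new nodes in creation order then computes each
-- level from already correct fanin levels, which gives the level of x'. Applying the
-- replacement only rewires fanouts of x, which are pending, and only deletes nodes upstream
-- of x, so the invariant survives the step.

module Submission where

open import Defs
open import Data.Nat using (ℕ; suc; _⊔_; _≡ᵇ_)
open import Data.Nat.Properties using (_≟_; ≡ᵇ⇒≡; ≡⇒≡ᵇ)
open import Data.Bool using (true; false)
open import Data.Bool.Properties using (T-≡; ¬-not; ∨-zeroʳ)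
open import Data.List using (List; []; _∷_; [_]; map)
open import Data.List.Membership.Propositional using (_∈_; _∉_)
open import Data.List.Membership.Propositional.Properties using (∈-map⁺; ∈-map⁻; ∈-++⁺ʳ)
open import Data.List.Membership.DecPropositional _≟_ using (_∈?_)
open import Data.List.Relation.Unary.All as All using (All; []; _∷_)
open import Data.List.Relation.Unary.All.Properties using (++⁺)
open import Data.List.Relation.Unary.Any using (here; there)
open import Data.List.Relation.Unary.AllPairs as AllPairs using (_∷_)
open import Data.List.Relation.Unary.Unique.Propositional using (Unique)
open import Data.Product using (∃; _×_; _,_; proj₁; proj₂)
open import Data.Sum using (_⊎_; inj₁; inj₂)
open import Data.Empty using (⊥-elim)
open import Data.Unit using (⊤; tt)
open import Function.Bundles using (Equivalence)
open import Relation.Nullary using (¬_; yes; no)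
open import Relation.Binary.PropositionalEquality using (_≡_; refl; sym; trans; cong; cong₂; subst; _≢_)

≡ᵇ-refl : ∀ n → (n ≡ᵇ n) ≡ true
≡ᵇ-refl n = Equivalence.to T-≡ (≡⇒≡ᵇ n n refl)

≡ᵇ-≢ : ∀ {m n} → m ≢ n → (m ≡ᵇ n) ≡ false
≡ᵇ-≢ {m} {n} m≢n = ¬-not (λ e → m≢n (≡ᵇ⇒≡ m n (Equivalence.from T-≡ e)))

isIn-∈ : ∀ {n ns} → n ∈ ns → isIn n ns ≡ true
isIn-∈ {n} (here refl) rewrite ≡ᵇ-refl n = refl
isIn-∈ {n} {m ∷ ms} (there p) rewrite isIn-∈ p = ∨-zeroʳ (n ≡ᵇ m)

isIn-∉ : ∀ {n} ns → n ∉ ns → isIn n ns ≡ false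
isIn-∉ [] _ = refl
isIn-∉ (m ∷ ms) n∉ rewrite ≡ᵇ-≢ (λ e → n∉ (here e)) = isIn-∉ ms (λ p → n∉ (there p))

and≢none : ∀ {G n a b} → gate G n ≡ and a b → Present G n
and≢none eq e with trans (sym eq) e
... | ()

pi≢none : ∀ {G n} → gate G n ≡ pi → Present G n
pi≢none eq e with trans (sym eq) e
... | ()

FaninOf⇒Present : ∀ {G f n} → FaninOf G f n → Present G n
FaninOf⇒Present {G} (fan₁ eq _) = and≢none {G} eq
FaninOf⇒Present {G} (fan₂ eq _) = and≢none {G} eq

FaninOf-pi : ∀ {G f n} → FaninOf G f n → gate G n ≢ pi
FaninOf-pi (fan₁ eq _) e with trans (sym eq) e
... | ()
FaninOf-pi (fan₂ eq _) e with trans (sym eq) e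
... | ()

gate-setGate-≡ : ∀ G i k → gate (setGate G i k) i ≡ k
gate-setGate-≡ G i k rewrite ≡ᵇ-refl i = refl

gate-setGate-≢ : ∀ G i k {n} → n ≢ i → gate (setGate G i k) n ≡ gate G n
gate-setGate-≢ G i k n≢i rewrite ≡ᵇ-≢ n≢i = refl

gate-insertNodes-∉ : ∀ G ds {n} → n ∉ map nid ds → gate (insertNodes G ds) n ≡ gate G n
gate-insertNodes-∉ G [] _ = refl
gate-insertNodes-∉ G (d ∷ ds) n∉ =
  trans (gate-insertNodes-∉ _ ds (λ p → n∉ (there p)))
        (gate-setGate-≢ G (nid d) _ (λ e → n∉ (here e)))

gate-insertNodes-∈ : ∀ G ds {d} → d ∈ ds → Unique (map nid ds) →
  gate (insertNodes G ds) (nid d) ≡ and (fa d) (fb d)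
gate-insertNodes-∈ G (d ∷ ds) (here refl) (d∉ ∷ _) =
  trans (gate-insertNodes-∉ _ ds (λ p → All.lookup d∉ p refl)) (gate-setGate-≡ G (nid d) _)
gate-insertNodes-∈ G (_ ∷ ds) (there d∈) (_ ∷ u) = gate-insertNodes-∈ _ ds d∈ u

FaninOf-resp-gate : ∀ {G H f n} → gate H n ≡ gate G n → FaninOf H f n → FaninOf G f n
FaninOf-resp-gate eq (fan₁ e a) = fan₁ (trans (sym eq) e) a
FaninOf-resp-gate eq (fan₂ e b) = fan₂ (trans (sym eq) e) b

redirectLit-node : ∀ x l a → node (redirectLit x l a) ≡ node l ⊎ redirectLit x l a ≡ a
redirectLit-node x (lit _ _) (lit m _) with m ≡ᵇ x
... | true = inj₁ refl
... | false = inj₂ refl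

redirectLit-≢ : ∀ x l a → node a ≢ x → redirectLit x l a ≡ a
redirectLit-≢ x (lit _ _) (lit m _) m≢x rewrite ≡ᵇ-≢ m≢x = refl

redirectKind-and : ∀ {x l a b} k → redirectKind x l k ≡ and a b →
  ∃ λ a′ → ∃ λ b′ → k ≡ and a′ b′ × a ≡ redirectLit x l a′ × b ≡ redirectLit x l b′
redirectKind-and (and a′ b′) refl = a′ , b′ , refl , refl , refl

module Redirection (H : AIG) (I : List ℕ) (x : ℕ) (l : Lit) where

  gate-redirect-∈ : ∀ {n} → n ∈ I → gate (redirect H I x l) n ≡ gate H n
  gate-redirect-∈ {n} n∈ rewrite isIn-∈ n∈ = refl

  gate-redirect-∉ : ∀ {n} → n ∉ I → gate (redirect H I x l) n ≡ redirectKind x l (gate H n)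
  gate-redirect-∉ {n} n∉ rewrite isIn-∉ I n∉ = refl

  gate-redirect-unaffected : ∀ {n} → ¬ FaninOf H x n → gate (redirect H I x l) n ≡ gate H n
  gate-redirect-unaffected {n} x∌n with n ∈? I
  ... | yes n∈ = gate-redirect-∈ n∈
  ... | no n∉ = trans (gate-redirect-∉ n∉) (redirectKind-unaffected (gate H n) refl)
    where
    redirectKind-unaffected : ∀ k → gate H n ≡ k → redirectKind x l k ≡ k
    redirectKind-unaffected none _ = refl
    redirectKind-unaffected pi _ = refl
    redirectKind-unaffected (and a b) eq =
      cong₂ and (redirectLit-≢ x l a (λ e → x∌n (fan₁ eq e)))
                (redirectLit-≢ x l b (λ e → x∌n (fan₂ eq e)))

  Present-redirect : ∀ {n} → Present H n → Present (redirect H I x l) n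
  Present-redirect {n} pr with n ∈? I
  ... | yes n∈ = λ e → pr (trans (sym (gate-redirect-∈ n∈)) e)
  ... | no n∉ = λ e → pr (redirectKind-none (gate H n) (trans (sym (gate-redirect-∉ n∉)) e))
    where
    redirectKind-none : ∀ k → redirectKind x l k ≡ none → k ≡ none
    redirectKind-none none _ = refl

  redirect-pi : ∀ {n} → gate (redirect H I x l) n ≡ pi → gate H n ≡ pi
  redirect-pi {n} eq with n ∈? I
  ... | yes n∈ = trans (sym (gate-redirect-∈ n∈)) eq
  ... | no n∉ = redirectKind-pi (gate H n) (trans (sym (gate-redirect-∉ n∉)) eq)
    where
    redirectKind-pi : ∀ k → redirectKind x l k ≡ pi → k ≡ pi
    redirectKind-pi pi _ = refl

  FaninOf-redirect : ∀ {f n} → FaninOf (redirect H I x l) f n →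
    FaninOf H f n ⊎ f ≡ node l
  FaninOf-redirect {f} {n} fo with n ∈? I
  ... | yes n∈ = inj₁ (FaninOf-resp-gate (gate-redirect-∈ n∈) fo)
  ... | no n∉ = redirected fo
    where
    viaLit : ∀ {a} → node (redirectLit x l a) ≡ f → (node a ≡ f → FaninOf H f n) →
      FaninOf H f n ⊎ f ≡ node l
    viaLit {a} e fanin with redirectLit-node x l a
    ... | inj₁ e′ = inj₂ (trans (sym e) e′)
    ... | inj₂ e′ = inj₁ (fanin (trans (cong node (sym e′)) e))
    redirected : FaninOf (redirect H I x l) f n → FaninOf H f n ⊎ f ≡ node l
    redirected (fan₁ eq e) with redirectKind-and (gate H n) (trans (sym (gate-redirect-∉ n∉)) eq)
    ... | _ , _ , eqH , refl , refl = viaLit e (fan₁ eqH)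
    redirected (fan₂ eq e) with redirectKind-and (gate H n) (trans (sym (gate-redirect-∉ n∉)) eq)
    ... | _ , _ , eqH , refl , refl = viaLit e (fan₂ eqH)

LevelCorrect : ℕ → AIG → (ℕ → ℕ) → ℕ → Set
LevelCorrect base H L n = Present H n → Level base H n (L n)

Level-transfer : ∀ {base G H} (P : ℕ → Set) →
  (∀ {m} → P m → Present G m → gate H m ≡ gate G m) →
  (∀ {f m} → P m → FaninOf G f m → P f) →
  ∀ {n l} → P n → Level base G n l → Level base H n l
Level-transfer {G = G} P agree closed pn (lpi e) = lpi (trans (agree pn (pi≢none {G} e)) e)
Level-transfer {G = G} P agree closed pn (land e la lb) =
  land (trans (agree pn (and≢none {G} e)) e)
       (Level-transfer P agree closed (closed pn (fan₁ e refl)) la)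
       (Level-transfer P agree closed (closed pn (fan₂ e refl)) lb)

recompute-≢ : ∀ L m k {n} → n ≢ m → recompute L m k n ≡ L n
recompute-≢ L m none _ = refl
recompute-≢ L m pi _ = refl
recompute-≢ L m (and a b) n≢m rewrite ≡ᵇ-≢ n≢m = refl

recompute-and : ∀ L n a b → recompute L n (and a b) n ≡ suc (L (node a) ⊔ L (node b))
recompute-and L n a b rewrite ≡ᵇ-refl n = refl

dynLev-∉ : ∀ H L ns {n} → n ∉ ns → dynLev H L ns n ≡ L n
dynLev-∉ H L [] _ = refl
dynLev-∉ H L (m ∷ ms) n∉ =
  trans (dynLev-∉ H _ ms (λ p → n∉ (there p))) (recompute-≢ L m (gate H m) (λ e → n∉ (here e)))

Built-fanins : ∀ {av ds d} → Built av ds → d ∈ ds →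
  (node (fa d) ∈ av ⊎ node (fa d) ∈ map nid ds) × (node (fb d) ∈ av ⊎ node (fb d) ∈ map nid ds)
Built-fanins (a∈ , b∈ , _) (here refl) = inj₁ a∈ , inj₁ b∈
Built-fanins {av} {d′ ∷ ds} (_ , _ , built) (there d∈) with Built-fanins built d∈
... | a , b = shift a , shift b
  where
  shift : ∀ {m} → m ∈ nid d′ ∷ av ⊎ m ∈ map nid ds → m ∈ av ⊎ m ∈ map nid (d′ ∷ ds)
  shift (inj₁ (here e)) = inj₂ (here e)
  shift (inj₁ (there m∈)) = inj₁ m∈
  shift (inj₂ m∈) = inj₂ (there m∈)

-- Since each new node reads only cut leaves and earlier new nodes, one pass in creation
-- order finds all its fanin levels already correct.
dynLev-Built : ∀ {base} H L av ds → Built av ds → Unique (map nid ds) →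
  (∀ {d} → d ∈ ds → nid d ∉ av) →
  (∀ {d} → d ∈ ds → Present H (nid d) → gate H (nid d) ≡ and (fa d) (fb d)) →
  FaninsPresent H →
  (∀ {a} → a ∈ av → LevelCorrect base H L a) →
  ∀ {n} → n ∈ av ⊎ n ∈ map nid ds → LevelCorrect base H (dynLev H L (map nid ds)) n
dynLev-Built H L av [] _ _ _ _ _ correct (inj₁ n∈) = correct n∈
dynLev-Built {base} H L av (d ∷ ds) (a∈ , b∈ , built) (d∉ ∷ unique) fresh declared fp correct mem =
  dynLev-Built H L′ (nid d ∷ av) ds built unique fresh′ (λ d∈ → declared (there d∈)) fp correct′ (shift mem)
  where
  L′ : ℕ → ℕ
  L′ = recompute L (nid d) (gate H (nid d))
  fresh′ : ∀ {d′} → d′ ∈ ds → nid d′ ∉ nid d ∷ av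
  fresh′ d′∈ (here e) = All.lookup d∉ (∈-map⁺ nid d′∈) (sym e)
  fresh′ d′∈ (there p) = fresh (there d′∈) p
  correct′ : ∀ {a} → a ∈ nid d ∷ av → LevelCorrect base H L′ a
  correct′ (here refl) pr with declared (here refl) pr
  ... | eq rewrite eq | recompute-and L (nid d) (fa d) (fb d) =
    land eq (correct a∈ (fp _ _ (fan₁ eq refl))) (correct b∈ (fp _ _ (fan₂ eq refl)))
  correct′ (there a∈) rewrite recompute-≢ L (nid d) (gate H (nid d))
                                (λ e → fresh (here refl) (subst (_∈ av) e a∈)) = correct a∈
  shift : ∀ {n} → n ∈ av ⊎ n ∈ map nid (d ∷ ds) → n ∈ nid d ∷ av ⊎ n ∈ map nid ds
  shift (inj₁ n∈) = inj₁ (there n∈)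
  shift (inj₂ (here e)) = inj₁ (here e)
  shift (inj₂ (there n∈)) = inj₂ n∈

Delete-gate : ∀ {H H′ ws} (S : ℕ → Set) →
  (∀ {y a b} → S y → gate H y ≡ and a b → S (node a) × S (node b)) →
  Delete H ws H′ → All S ws →
  ∀ n → gate H′ n ≡ gate H n ⊎ (gate H′ n ≡ none × S n)
Delete-gate {H} S closed del-ws S-ws = go del-ws (λ _ → inj₁ refl) S-ws
  where
  UnchangedOrDeleted : AIG → ℕ → Set
  UnchangedOrDeleted K n = gate K n ≡ gate H n ⊎ (gate K n ≡ none × S n)
  go : ∀ {K K′ ws} → Delete K ws K′ → (∀ n → UnchangedOrDeleted K n) → All S ws → ∀ n → UnchangedOrDeleted K′ n
  go done unchanged _ = unchanged
  go {K} (del {y = y} {a = a} {b = b} eq _ rest) unchanged (Sy ∷ S-ws) =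
    go rest unchanged-or-deleted′ (++⁺ S-ws (proj₁ S-ab ∷ proj₂ S-ab ∷ []))
    where
    eqH : gate H y ≡ and a b
    eqH with unchanged y
    ... | inj₁ e = trans (sym e) eq
    ... | inj₂ (e , _) = ⊥-elim (and≢none {K} eq e)
    S-ab : S (node a) × S (node b)
    S-ab = closed Sy eqH
    unchanged-or-deleted′ : ∀ n → UnchangedOrDeleted (setGate K y none) n
    unchanged-or-deleted′ n with n ≟ y
    ... | yes refl = inj₂ (gate-setGate-≡ K n none , Sy)
    ... | no n≢y rewrite gate-setGate-≢ K y none n≢y = unchanged n
  go (keep _ rest) unchanged (_ ∷ S-ws) = go rest unchanged S-ws

Delete-FaninsPresent : ∀ {H H′ ws} → Delete H ws H′ → FaninsPresent H → FaninsPresent H′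
Delete-FaninsPresent done fp = fp
Delete-FaninsPresent {H} (del {y = y} _ fanout-free rest) fp = Delete-FaninsPresent rest fp′
  where
  gate-≢y : ∀ {n} → gate (setGate H y none) n ≢ none → n ≢ y
  gate-≢y pr refl = pr (gate-setGate-≡ H _ none)
  fanin-H : ∀ {f n} → FaninOf (setGate H y none) f n → FaninOf H f n
  fanin-H fo = FaninOf-resp-gate (gate-setGate-≢ H y none (gate-≢y (FaninOf⇒Present fo))) fo
  fp′ : FaninsPresent (setGate H y none)
  fp′ f n fo with f ≟ y
  ... | yes refl = ⊥-elim (fanout-free (inj₁ (n , fanin-H fo)))
  ... | no f≢y rewrite gate-setGate-≢ H y none f≢y = fp f n (fanin-H fo)
Delete-FaninsPresent (keep _ rest) fp = Delete-FaninsPresent rest fp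

Unique-head-∉ : ∀ {x : ℕ} {T} → Unique (x ∷ T) → x ∉ T
Unique-head-∉ (x∉ ∷ _) x∈ = All.lookup x∉ x∈ refl

Before-∈ʳ : ∀ {T m n} → Before T m n → n ∈ T
Before-∈ʳ (bhere n∈) = there n∈
Before-∈ʳ (bthere b) = there (Before-∈ʳ b)

Before-head : ∀ {x T m} → Unique (x ∷ T) → ¬ Before (x ∷ T) m x
Before-head u (bhere x∈) = Unique-head-∉ u x∈
Before-head u (bthere b) = Unique-head-∉ u (Before-∈ʳ b)

Before-tail : ∀ {x T m n} → Unique (x ∷ T) → m ∈ T → Before (x ∷ T) m n → Before T m n
Before-tail u m∈ (bhere _) = ⊥-elim (Unique-head-∉ u m∈)
Before-tail _ _ (bthere b) = b

Settled : AIG → List ℕ → ℕ → Set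
Settled G T n = n ∉ T ⊎ gate G n ≡ pi

-- Pending primary inputs count as settled: dynLev never changes their stored level.
record Invariant (base : ℕ) (G : AIG) (L : ℕ → ℕ) (T : List ℕ) : Set where
  field
    unique          : Unique T
    ordered         : ∀ {m n} → m ∈ T → n ∈ T → Path⁺ G m n → Before T m n
    pending-present : ∀ {n} → n ∈ T → Present G n
    fanins-present  : FaninsPresent G
    fanouts-pending : ∀ {f n} → f ∈ T → FaninOf G f n → n ∈ T
    settled-correct : ∀ {n} → Settled G T n → LevelCorrect base G L n

Initial⇒Invariant : ∀ {base G L T} → Initial base (st G L T) → Invariant base G L T
Initial⇒Invariant ((_ , _ , fp) , levels , all-pending , pending , unique , ordered) = record
  { unique          = unique
  ; ordered         = λ m∈ n∈ → ordered _ _ m∈ n∈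
  ; pending-present = All.lookup pending
  ; fanins-present  = fp
  ; fanouts-pending = λ _ fo → all-pending _ (FaninOf⇒Present fo)
  ; settled-correct = λ _ → levels _
  }

module Processing {base G L x T} (I : Invariant base G L (x ∷ T)) where
  open Invariant I

  no-Path⁺-to-x : ∀ {m} → m ∈ x ∷ T → ¬ Path⁺ G m x
  no-Path⁺-to-x m∈ p = Before-head unique (ordered m∈ (here refl) p)

  upstream-∉ : ∀ {n} → Path G n x → n ∉ T
  upstream-∉ here = Unique-head-∉ unique
  upstream-∉ (step fo p) n∈ = no-Path⁺-to-x (there n∈) (_ , fo , p)

  upstream-present : ∀ {n} → Path G n x → Present G n
  upstream-present here = pending-present (here refl)
  upstream-present (step fo _) = fanins-present _ _ fo

  fanout-of-pending : ∀ {f m} → f ∈ x ∷ T → FaninOf G f m → m ∈ T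
  fanout-of-pending f∈ fo with fanouts-pending f∈ fo
  ... | here refl = ⊥-elim (no-Path⁺-to-x f∈ (_ , fo , here))
  ... | there m∈ = m∈

  settled-fanin : ∀ {f m} → Settled G T m → f ∈ x ∷ T → ¬ FaninOf G f m
  settled-fanin (inj₁ m∉) f∈ fo = m∉ (fanout-of-pending f∈ fo)
  settled-fanin (inj₂ m-pi) _ fo = FaninOf-pi fo m-pi

  L₁ : ℕ → ℕ
  L₁ = dynLev G L [ x ]

  settled-correct₁ : ∀ {n} → Settled G T n → LevelCorrect base G L₁ n
  settled-correct₁ {n} settled pr with n ≟ x
  ... | no n≢x rewrite recompute-≢ L x (gate G x) n≢x = settled-correct (widen settled) pr
    where
    widen : Settled G T n → Settled G (x ∷ T) n
    widen (inj₁ n∉) = inj₁ λ { (here e) → n≢x e ; (there n∈) → n∉ n∈ }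
    widen (inj₂ n-pi) = inj₂ n-pi
  ... | yes refl = processed (gate G x) refl
    where
    fanin-correct : ∀ {f} → FaninOf G f x → Level base G f (L f)
    fanin-correct fo =
      settled-correct (inj₁ λ f∈ → no-Path⁺-to-x f∈ (_ , fo , here)) (fanins-present _ _ fo)
    processed : ∀ k → gate G x ≡ k → Level base G x (recompute L x k x)
    processed none eq = ⊥-elim (pr eq)
    processed pi eq = settled-correct (inj₂ eq) pr
    processed (and a b) eq rewrite recompute-and L x a b =
      land eq (fanin-correct (fan₁ eq refl)) (fanin-correct (fan₂ eq refl))

  Invariant-noChange : Invariant base G L₁ T
  Invariant-noChange = record
    { unique          = AllPairs.tail unique
    ; ordered         = λ m∈ n∈ p → Before-tail unique m∈ (ordered (there m∈) (there n∈) p)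
    ; pending-present = λ n∈ → pending-present (there n∈)
    ; fanins-present  = fanins-present
    ; fanouts-pending = λ f∈ → fanout-of-pending (there f∈)
    ; settled-correct = settled-correct₁
    }

module Replacement {k base G L x T c} (I : Invariant base G L (x ∷ T)) (vc : ValidCandidate k G x c) where
  open Invariant I
  open Processing I

  G₁ : AIG
  G₁ = insertCand G c

  new : List ℕ
  new = inserted c

  x′ : ℕ
  x′ = nid (root c)

  x′-lit : Lit
  x′-lit = lit x′ (pol c)

  R : AIG
  R = redirect G₁ new x x′-lit

  open Redirection G₁ new x x′-lit

  leaf-upstream : ∀ {l} → l ∈ leaves c → Path G l x
  leaf-upstream = proj₂ (proj₂ (proj₁ vc)) _

  new-unique : Unique new
  new-unique = proj₁ (proj₂ (proj₂ vc))

  built : Built (leaves c) (created c)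
  built = proj₁ (proj₂ (proj₂ (proj₂ vc)))

  new-∉ : ∀ {n} → Present G n → n ∉ new
  new-∉ pr n∈ with ∈-map⁻ nid n∈
  ... | _ , d∈ , refl = pr (All.lookup (proj₁ (proj₂ vc)) d∈)

  x′∈new : x′ ∈ new
  x′∈new = ∈-map⁺ nid (∈-++⁺ʳ (body c) (here refl))

  leaf-present : ∀ {l} → l ∈ leaves c → Present G l
  leaf-present l∈ = upstream-present (leaf-upstream l∈)

  leaf-fresh : ∀ {d} → d ∈ created c → nid d ∉ leaves c
  leaf-fresh d∈ l∈ = new-∉ (leaf-present l∈) (∈-map⁺ nid d∈)

  gate-G₁-old : ∀ {n} → n ∉ new → gate G₁ n ≡ gate G n
  gate-G₁-old = gate-insertNodes-∉ G (created c)

  gate-G₁-new : ∀ {d} → d ∈ created c → gate G₁ (nid d) ≡ and (fa d) (fb d)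
  gate-G₁-new d∈ = gate-insertNodes-∈ G (created c) d∈ new-unique

  Present-G₁-old : ∀ {n} → Present G n → Present G₁ n
  Present-G₁-old pr e = pr (trans (sym (gate-G₁-old (new-∉ pr))) e)

  Present-G₁-new : ∀ {n} → n ∈ new → Present G₁ n
  Present-G₁-new n∈ with ∈-map⁻ nid n∈
  ... | _ , d∈ , refl = and≢none {G₁} (gate-G₁-new d∈)

  FaninOf-G₁ : ∀ {f n} → FaninOf G₁ f n → FaninOf G f n ⊎ (f ∈ leaves c ⊎ f ∈ new)
  FaninOf-G₁ {n = n} fo with n ∈? new
  ... | no n∉ = inj₁ (FaninOf-resp-gate (gate-G₁-old n∉) fo)
  ... | yes n∈ with ∈-map⁻ nid n∈
  ...   | _ , d∈ , refl = inj₂ (new-fanin fo)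
    where
    new-fanin : ∀ {f} → FaninOf G₁ f _ → f ∈ leaves c ⊎ f ∈ new
    new-fanin (fan₁ eq refl) with trans (sym eq) (gate-G₁-new d∈)
    ... | refl = proj₁ (Built-fanins built d∈)
    new-fanin (fan₂ eq refl) with trans (sym eq) (gate-G₁-new d∈)
    ... | refl = proj₂ (Built-fanins built d∈)

  fanins-present₁ : FaninsPresent G₁
  fanins-present₁ f n fo with FaninOf-G₁ fo
  ... | inj₁ foG = Present-G₁-old (fanins-present f n foG)
  ... | inj₂ (inj₁ l∈) = Present-G₁-old (leaf-present l∈)
  ... | inj₂ (inj₂ f∈) = Present-G₁-new f∈

  leaf-settled : ∀ {l} → l ∈ leaves c → Settled G T l
  leaf-settled l∈ = inj₁ (upstream-∉ (leaf-upstream l∈))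

  leaf-correct₁ : ∀ {l} → l ∈ leaves c → LevelCorrect base G₁ L₁ l
  leaf-correct₁ l∈ _ =
    Level-transfer (λ _ → ⊤) (λ _ pr → gate-G₁-old (new-∉ pr)) (λ _ _ → tt) tt
      (settled-correct₁ (leaf-settled l∈) (leaf-present l∈))

  root-correct : Level base G₁ x′ (dynLev G₁ L₁ new x′)
  root-correct =
    dynLev-Built G₁ L₁ (leaves c) (created c) built new-unique leaf-fresh (λ d∈ _ → gate-G₁-new d∈)
      fanins-present₁ leaf-correct₁ (inj₂ x′∈new) (Present-G₁-new x′∈new)

  FaninOf-R : ∀ {f n} → FaninOf R f n → FaninOf G f n ⊎ (f ∈ leaves c ⊎ f ∈ new)
  FaninOf-R fo with FaninOf-redirect fo
  ... | inj₁ fo₁ = FaninOf-G₁ fo₁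
  ... | inj₂ refl = inj₂ (inj₂ x′∈new)

  FaninOf-R-pending : ∀ {f n} → f ∈ T → FaninOf R f n → FaninOf G f n
  FaninOf-R-pending f∈ fo with FaninOf-R fo
  ... | inj₁ foG = foG
  ... | inj₂ (inj₁ l∈) = ⊥-elim (upstream-∉ (leaf-upstream l∈) f∈)
  ... | inj₂ (inj₂ f∈new) = ⊥-elim (new-∉ (pending-present (there f∈)) f∈new)

  fanins-present-R : FaninsPresent R
  fanins-present-R f n fo with FaninOf-redirect fo
  ... | inj₁ fo₁ = Present-redirect (fanins-present₁ f n fo₁)
  ... | inj₂ refl = Present-redirect (Present-G₁-new x′∈new)

  gate-R-old : ∀ {n} → Present G n → ¬ FaninOf G x n → gate R n ≡ gate G n
  gate-R-old pr x∌n =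
    trans (gate-redirect-unaffected (λ fo → x∌n (FaninOf-resp-gate (gate-G₁-old n∉) fo))) (gate-G₁-old n∉)
    where n∉ = new-∉ pr

  gate-R-upstream : ∀ {m} → Path G m x → gate R m ≡ gate G m
  gate-R-upstream p = gate-R-old (upstream-present p) (λ fo → no-Path⁺-to-x (here refl) (_ , fo , p))

  module Deletion {G₂ : AIG} (deletion : Delete R [ x ] G₂) where

    -- Only nodes upstream of x can be deleted: deletion starts at x and walks fanins.
    gate-G₂ : ∀ n → gate G₂ n ≡ gate R n ⊎ (gate G₂ n ≡ none × Path G n x)
    gate-G₂ = Delete-gate (λ n → Path G n x) upstream-fanins deletion (here ∷ [])
      where
      upstream-fanins : ∀ {y a b} → Path G y x → gate R y ≡ and a b →
        Path G (node a) x × Path G (node b) x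
      upstream-fanins p eq = step (fan₁ eqG refl) p , step (fan₂ eqG refl) p
        where eqG = trans (sym (gate-R-upstream p)) eq

    gate-G₂-present : ∀ {n} → Present G₂ n → gate G₂ n ≡ gate R n
    gate-G₂-present {n} pr with gate-G₂ n
    ... | inj₁ e = e
    ... | inj₂ (e , _) = ⊥-elim (pr e)

    FaninOf-G₂ : ∀ {f n} → FaninOf G₂ f n → FaninOf R f n
    FaninOf-G₂ fo = FaninOf-resp-gate (gate-G₂-present (FaninOf⇒Present {G₂} fo)) fo

    fanins-present₂ : FaninsPresent G₂
    fanins-present₂ = Delete-FaninsPresent deletion fanins-present-R

    FaninOf-G₂-pending : ∀ {f n} → f ∈ T → FaninOf G₂ f n → FaninOf G f n
    FaninOf-G₂-pending f∈ fo = FaninOf-R-pending f∈ (FaninOf-G₂ fo)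

    fanouts-pending₂ : ∀ {f n} → f ∈ T → FaninOf G₂ f n → n ∈ T
    fanouts-pending₂ f∈ fo = fanout-of-pending (there f∈) (FaninOf-G₂-pending f∈ fo)

    Path-G₂-pending : ∀ {m n} → m ∈ T → Path G₂ m n → Path G m n
    Path-G₂-pending m∈ here = here
    Path-G₂-pending m∈ (step fo p) =
      step (FaninOf-G₂-pending m∈ fo) (Path-G₂-pending (fanouts-pending₂ m∈ fo) p)

    ordered₂ : ∀ {m n} → m ∈ T → n ∈ T → Path⁺ G₂ m n → Before T m n
    ordered₂ m∈ n∈ (_ , fo , p) =
      Before-tail unique m∈ (ordered (there m∈) (there n∈)
        (_ , FaninOf-G₂-pending m∈ fo , Path-G₂-pending (fanouts-pending₂ m∈ fo) p))

    pending-present₂ : ∀ {n} → n ∈ T → Present G₂ n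
    pending-present₂ {n} n∈ with gate-G₂ n
    ... | inj₁ e = λ e′ → Present-redirect (Present-G₁-old (pending-present (there n∈))) (trans (sym e) e′)
    ... | inj₂ (_ , p) = ⊥-elim (upstream-∉ p n∈)

    L₂ : ℕ → ℕ
    L₂ = dynLev G₂ L₁ new

    Survivor : ℕ → Set
    Survivor n = Present G₂ n × Settled G T n

    survivor-gate : ∀ {m} → Survivor m → Present G m → gate G₂ m ≡ gate G m
    survivor-gate (pr , settled) prG =
      trans (gate-G₂-present pr) (gate-R-old prG (settled-fanin settled (here refl)))

    survivor-fanin : ∀ {f m} → Survivor m → FaninOf G f m → Survivor f
    survivor-fanin s fo =
      fanins-present₂ _ _ (FaninOf-resp-gate (sym (survivor-gate s (FaninOf⇒Present fo))) fo)
      , inj₁ (λ f∈ → settled-fanin (proj₂ s) (there f∈) fo)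

    survivor-correct : ∀ {n} → Survivor n → Present G n → Level base G₂ n (L₁ n)
    survivor-correct s prG =
      Level-transfer Survivor survivor-gate survivor-fanin s (settled-correct₁ (proj₂ s) prG)

    settled-correct₂ : ∀ {n} → Settled G₂ T n → LevelCorrect base G₂ L₂ n
    settled-correct₂ {n} settled pr with n ∈? new
    ... | yes n∈ =
      dynLev-Built G₂ L₁ (leaves c) (created c) built new-unique leaf-fresh declared fanins-present₂
        (λ l∈ pr′ → survivor-correct (pr′ , leaf-settled l∈) (leaf-present l∈)) (inj₂ n∈) pr
      where
      declared : ∀ {d} → d ∈ created c → Present G₂ (nid d) → gate G₂ (nid d) ≡ and (fa d) (fb d)
      declared d∈ pr′ =
        trans (gate-G₂-present pr′) (trans (gate-redirect-∈ (∈-map⁺ nid d∈)) (gate-G₁-new d∈))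
    ... | no n∉ rewrite dynLev-∉ G₂ L₁ new n∉ = survivor-correct (pr , settled-old settled) prG
      where
      gate-G₂-old : gate G₂ n ≡ redirectKind x x′-lit (gate G n)
      gate-G₂-old = trans (gate-G₂-present pr) (trans (gate-redirect-∉ n∉) (cong (redirectKind x x′-lit) (gate-G₁-old n∉)))
      prG : Present G n
      prG e = pr (trans gate-G₂-old (cong (redirectKind x x′-lit) e))
      settled-old : Settled G₂ T n → Settled G T n
      settled-old (inj₁ n∉T) = inj₁ n∉T
      settled-old (inj₂ n-pi) =
        inj₂ (trans (sym (gate-G₁-old n∉)) (redirect-pi (trans (sym (gate-G₂-present pr)) n-pi)))

    Invariant-replace : Invariant base G₂ L₂ T
    Invariant-replace = record
      { unique          = AllPairs.tail unique
      ; ordered         = ordered₂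
      ; pending-present = pending-present₂
      ; fanins-present  = fanins-present₂
      ; fanouts-pending = fanouts-pending₂
      ; settled-correct = settled-correct₂
      }

Reachable⇒Invariant : ∀ {k base S} → Reachable k base S → Invariant base (graph S) (levels S) (order S)
Reachable⇒Invariant (init initial) = Initial⇒Invariant initial
Reachable⇒Invariant (next r noChange) = Processing.Invariant-noChange (Reachable⇒Invariant r)
Reachable⇒Invariant (next r (replace vc deletion)) =
  Replacement.Deletion.Invariant-replace (Reachable⇒Invariant r) vc deletion

theorem4 : (k base : ℕ) (G : AIG) (L : ℕ → ℕ) (x : ℕ) (T : List ℕ) →
    Reachable k base (st G L (x ∷ T)) →
    (c : Candidate) → ValidCandidate k G x c →
    Level base (insertCand G c) (nid (root c))
      (dynLev (insertCand G c) (dynLev G L [ x ]) (inserted c) (nid (root c)))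
theorem4 k base G L x T r c vc = Replacement.root-correct (Reachable⇒Invariant r) vc
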